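{- Let $(w_i)_{i\in\mathbb{Z}}$ be a bi-infinite sequence of bi-infinite binary words with $w_i\,\mathcal{T}_C\,w_{i+1}$ for every $i\in\mathbb{Z}$. Then for every $i\in\mathbb{Z}$, the word $w_i$ contains neither $010$ nor $101$ as a factor.
   Context: A Wang set $(H,V,T)$, $T\subseteq H^2\times V^2$, is viewed as a finite transducer without initial or final states: $H$ is the set of states, $V$ the input/output alphabet, and a tile $(w,e,s,n)$ is a transition from state $w$ to state $e$ reading $s$ and writing $n$. For bi-infinite words $u,u'\in V^{\mathbb{Z}}$, write $u\,\mathcal{T}\,u'$ if there is a bi-infinite sequence of states $(q_k)_{k\in\mathbb{Z}}$ such that for every $k$ there is a transition from $q_k$ to $q_{k+1}$ reading $u[k]$ and writing $u'[k]$. $\mathcal{T}_C$ is the transducer over $V=\{0,1\}$ which is the disjoint union of the following two transducers (notation $p\to q:\ x|y$ for a transition from $p$ to $q$ reading $x$ and writing $y$). First component, states $a,b,c,d,e,f,g,h,i,j$: $a\to b:1|0$; $f\to b:1|1$; $g\to a:1|1$; $e\to f:1|1$; $c\to d:1|0$; $b\to c:1|0$; $b\to g:1|1$; $d\to e:1|1$; $i\to j:0|0$; $c\to i:0|0$; $d\to h:0|0$; $j\to a:0|0$; $h\to c:0|0$; $h\to g:0|1$. Second component, states $K,L,M,N,O,P,Q,R$: $P\to R:1|1$; $M\to K:1|1$; $R\to M:1|1$; $Q\to O:0|0$; $N\to O:0|1$; $P\to Q:0|1$; $M\to N:0|1$; $R\to L:0|0$; $K\to L:0|1$; $O\to R:0|0$;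 $O\to P:0|1$; $L\to M:0|1$. -}

module Defs where

open import Data.Bool using (Bool; true; false)
open import Data.Integer using (ℤ; _+_; +_)
open import Data.Product using (Σ; ∃; _×_)
open import Relation.Binary.PropositionalEquality using (_≡_)
open import Relation.Nullary using (¬_)

-- Bi-infinite binary words: V = {0,1} encoded as Bool (false = 0, true = 1).
BiWord : Set
BiWord = ℤ → Bool

-- A transducer without initial/final states: states Q, transitions
-- Trans p q x y  means  p → q : x | y  (read x, write y).
-- u 𝒯 u'  iff there is a bi-infinite run (q_k) with a transition
-- q_k → q_{k+1} : u[k] | u'[k] for all k.
Related : {Q : Set} → (Q → Q → Bool → Bool → Set) → BiWord → BiWord → Set
Related {Q} Trans u u' =
  Σ (ℤ → Q) λ q → ∀ (k : ℤ) → Trans (q k) (q (k + + 1)) (u k) (u' k)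

data StateC : Set where
  a b c d e f g h i j : StateC
  K L M N O P Q R : StateC

data TransC : StateC → StateC → Bool → Bool → Set where
  a→b : TransC a b true false
  f→b : TransC f b true true
  g→a : TransC g a true true
  e→f : TransC e f true true
  c→d : TransC c d true false
  b→c : TransC b c true false
  b→g : TransC b g true true
  d→e : TransC d e true true
  i→j : TransC i j false false
  c→i : TransC c i false false
  d→h : TransC d h false false
  j→a : TransC j a false false
  h→c : TransC h c false false
  h→g : TransC h g false true
  P→R : TransC P R true true
  M→K : TransC M K true true
  R→M : TransC R M true true
  Q→O : TransC Q O false false
  N→O : TransC N O false true
  P→Q : TransC P Q false true
  M→N : TransC M N false true
  R→L : TransC R L false false
  K→L : TransC K L false true
  O→R : TransC O R false false
  O→P : TransC O P false true
  L→M : TransC L M false true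

_𝒯C_ : BiWord → BiWord → Set
u 𝒯C u' = Related TransC u u'

HasFactor3 : BiWord → Bool → Bool → Bool → Set
HasFactor3 w x y z =
  ∃ λ (k : ℤ) → (w k ≡ x) × (w (k + + 1) ≡ y) × (w (k + + 2) ≡ z)

-- In 𝒯_C every state reached by reading 1 then 0 (h, i, L, N) has only
-- 0-transitions, and every state reached by writing 0 then 1 (g, e, M, P)
-- only writes 1.  So no word on the input side of 𝒯_C contains 101 and no
-- word on the output side contains 010; every w n is on both sides.
module Submission where

open import Defs
open import Data.Bool using (Bool; true; false)
open import Data.Integer using (ℤ; _+_; +_; -_; _-_)
open import Data.Integer.Properties using (+-assoc; +-identityʳ)
open import Data.Product using (∃; _×_; _,_)
open import Relation.Nullary using (¬_)
open import Relation.Binary.PropositionalEquality using (_≡_; refl; trans; subst)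

k+1+1≡k+2 : ∀ k → k + + 1 + + 1 ≡ k + + 2
k+1+1≡k+2 k = +-assoc k (+ 1) (+ 1)

n-1+1≡n : ∀ n → n - + 1 + + 1 ≡ n
n-1+1≡n n = trans (+-assoc n (- + 1) (+ 1)) (+-identityʳ n)

module _ {Q : Set} (Trans : Q → Q → Bool → Bool → Set) where

  Path3 : (x y z x′ y′ z′ : Bool) → Set
  Path3 x y z x′ y′ z′ =
    ∃ λ p → ∃ λ q → ∃ λ r → ∃ λ s →
      Trans p q x x′ × Trans q r y y′ × Trans r s z z′

  run-window : ∀ {u u′} → Related Trans u u′ → ∀ k →
    Path3 (u k) (u (k + + 1)) (u (k + + 2)) (u′ k) (u′ (k + + 1)) (u′ (k + + 2))
  run-window {u} {u′} (q , t) k =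
    q k , q (k + + 1) , q (k + + 2) , q (k + + 2 + + 1) ,
    t k , middle , t (k + + 2)
    where
    middle : Trans (q (k + + 1)) (q (k + + 2)) (u (k + + 1)) (u′ (k + + 1))
    middle = subst (λ m → Trans (q (k + + 1)) (q m) (u (k + + 1)) (u′ (k + + 1)))
                   (k+1+1≡k+2 k) (t (k + + 1))

  input-avoids : ∀ {u u′ x y z} → (∀ {x′ y′ z′} → ¬ Path3 x y z x′ y′ z′) →
    Related Trans u u′ → ¬ HasFactor3 u x y z
  input-avoids noPath run (k , refl , refl , refl) = noPath (run-window run k)

  output-avoids : ∀ {u u′ x′ y′ z′} → (∀ {x y z} → ¬ Path3 x y z x′ y′ z′) →
    Related Trans u u′ → ¬ HasFactor3 u′ x′ y′ z′
  output-avoids noPath run (k , refl , refl , refl) = noPath (run-window run k)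

TransC-reads-no-101 : ∀ {x′ y′ z′} → ¬ Path3 TransC true false true x′ y′ z′
TransC-reads-no-101 (_ , _ , _ , _ , c→d , d→h , ())
TransC-reads-no-101 (_ , _ , _ , _ , b→c , c→i , ())
TransC-reads-no-101 (_ , _ , _ , _ , P→R , R→L , ())
TransC-reads-no-101 (_ , _ , _ , _ , M→K , K→L , ())
TransC-reads-no-101 (_ , _ , _ , _ , R→M , M→N , ())

TransC-writes-no-010 : ∀ {x y z} → ¬ Path3 TransC x y z false true false
TransC-writes-no-010 (_ , _ , _ , _ , a→b , b→g , ())
TransC-writes-no-010 (_ , _ , _ , _ , c→d , d→e , ())
TransC-writes-no-010 (_ , _ , _ , _ , d→h , h→g , ())
TransC-writes-no-010 (_ , _ , _ , _ , Q→O , O→P , ())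
TransC-writes-no-010 (_ , _ , _ , _ , R→L , L→M , ())
TransC-writes-no-010 (_ , _ , _ , _ , O→R , R→M , ())

mainTheorem3 : (w : ℤ → BiWord) → (∀ (n : ℤ) → w n 𝒯C w (n + + 1)) →
    ∀ (n : ℤ) → ¬ HasFactor3 (w n) false true false × ¬ HasFactor3 (w n) true false true
mainTheorem3 w rel n = no010 , no101
  where
  no010 : ¬ HasFactor3 (w n) false true false
  no010 = subst (λ m → ¬ HasFactor3 (w m) false true false) (n-1+1≡n n)
                (output-avoids TransC TransC-writes-no-010 (rel (n - + 1)))

  no101 : ¬ HasFactor3 (w n) true false true
  no101 = input-avoids TransC TransC-reads-no-101 (rel n)
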